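{- Let $t\ge 3$ and $n\ge 1$ be integers and let $A\subseteq\{1,2,\dots,n\}$ be a set containing no three distinct elements $a,b,c$ with $\lambda a+\mu b=(\lambda+\mu)c$ for some positive integers $\lambda,\mu\le t-2$. Let $V=\{(i,\ell):1\le i\le t,\ 1\le \ell\le in\}$, and let $\mathcal S$ be the family of $t$-element subsets of $V$ of the form $\{(1,\ell),(2,\ell+k),(3,\ell+2k),\dots,(t,\ell+(t-1)k)\}$ with $1\le \ell\le n$ and $k\in A$. For each member of $\mathcal S$ take the complete graph $K_t$ on its $t$ vertices, and let the graph $H$ on $V$ be the union of these complete graphs. Then these copies of $K_t$ are pairwise edge-disjoint (so $H$ is a simple graph decomposed into them), $H$ contains no triangle whose three edges belong to three different copies of $K_t$ from this family, and if $|A|\ge n e^{ -c\sqrt{\log n}}$ for a constant $c$, then the family contains $n|A|\ge n^2e^{ -O(\sqrt{\log n})}$ distinct copies of $K_t$.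
   Context: Here $|V|=\frac{t(t+1)}{2}n$. A triple $a,b,c$ satisfying $\lambda a+\mu b=(\lambda+\mu)c$ with positive integers $\lambda,\mu\le q$ is called a triple with $q$-limited ratio; the hypothesis is that $A$ contains no such triple of distinct elements with $q=t-2$. -}

module Defs where

open import Data.Nat using (ℕ; _+_; _*_; _∸_; _≤_)
open import Data.Product using (_×_; Σ; ∃; _,_)
open import Relation.Binary.PropositionalEquality using (_≡_)
open import Relation.Nullary using (¬_)
open import Function.Bundles using (_⇔_)

SubsetOf1toN : ℕ → (ℕ → Set) → Set
SubsetOf1toN n A = ∀ a → A a → (1 ≤ a) × (a ≤ n)

NoLimitedRatioTriple : ℕ → (ℕ → Set) → Set
NoLimitedRatioTriple q A =
  ∀ a b c lam mu → A a → A b → A c →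
  ¬ (a ≡ b) → ¬ (b ≡ c) → ¬ (a ≡ c) →
  1 ≤ lam → lam ≤ q → 1 ≤ mu → mu ≤ q →
  ¬ (lam * a + mu * b ≡ (lam + mu) * c)

Vertex : Set
Vertex = ℕ × ℕ

-- Parameters (ℓ , k) of a member of the family 𝒮: 1 ≤ ℓ ≤ n, k ∈ A
Param : Set
Param = ℕ × ℕ

ValidParam : ℕ → (ℕ → Set) → Param → Set
ValidParam n A (l , k) = (1 ≤ l) × (l ≤ n) × A k

InCopy : ℕ → Param → Vertex → Set
InCopy t (l , k) (i , m) = (1 ≤ i) × (i ≤ t) × (m ≡ l + (i ∸ 1) * k)

EdgeOfCopy : ℕ → Param → Vertex → Vertex → Set
EdgeOfCopy t p u v = ¬ (u ≡ v) × InCopy t p u × InCopy t p v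

{-# OPTIONS --safe #-}
-- A copy with parameters (ℓ , k) is the arithmetic progression a ↦ ℓ + a k read
-- along the rows, so two copies sharing vertices in two different rows coincide.
-- Sort the vertices of a triangle whose edges lie in three different copies by
-- row, a < a + λ < a + λ + μ.  Going from the lowest to the highest vertex
-- directly, or through the middle one, gives λ k₁ + μ k₂ = (λ + μ) k₃ with
-- 1 ≤ λ, μ ≤ t − 2; any two of the copies meet in a vertex, so equal slopes would
-- make them equal.  Hence k₁, k₂, k₃ is a forbidden triple in A.
module Submission where

open import Defs
open import Data.Nat using (ℕ; _≤_; _∸_; _+_; _*_; _<_; suc; s≤s; z≤n; z<s; s≤s⁻¹)
open import Data.Nat.Properties
open import Data.Product using (_×_; _,_; ∃; proj₁; proj₂)
open import Relation.Binary.PropositionalEquality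
open import Relation.Binary.Definitions using (tri<; tri≈; tri>)
open import Relation.Nullary using (¬_; contradiction)
open import Data.Empty using (⊥)
open import Function.Base using (_∘_)
open import Function.Bundles using (_⇔_; Equivalence)

-- Row suc a of the copy p contains exactly the vertex (suc a , term p a).
term : Param → ℕ → ℕ
term (l , k) a = l + a * k

slope : Param → ℕ
slope = proj₂

term-+ : ∀ p a d → term p (a + d) ≡ term p a + d * slope p
term-+ (l , k) a d = begin
  l + (a + d) * k      ≡⟨ cong (l +_) (*-distribʳ-+ k a d) ⟩
  l + (a * k + d * k)  ≡⟨ +-assoc l (a * k) (d * k) ⟨
  l + a * k + d * k    ∎
  where open ≡-Reasoning

<⇒∃+suc : ∀ {a b} → a < b → ∃ λ d → a + suc d ≡ b
<⇒∃+suc {a} a<b = let d , eq = m≤n⇒∃[o]m+o≡n a<b in d , trans (+-suc a d) eq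

≡-by-term-and-slope : ∀ {p p'} a → term p a ≡ term p' a → slope p ≡ slope p' → p ≡ p'
≡-by-term-and-slope {l , k} {l' , .k} a eq refl = cong (_, k) (+-cancelʳ-≡ (a * k) l l' eq)

slope-≡-by-two-terms : ∀ p p' a d →
  term p a ≡ term p' a → term p (a + suc d) ≡ term p' (a + suc d) → slope p ≡ slope p'
slope-≡-by-two-terms p p' a d eqᵃ eqᵇ =
  *-cancelˡ-≡ (slope p) (slope p') (suc d) (+-cancelˡ-≡ (term p a) _ _ (begin
    term p a + suc d * slope p     ≡⟨ term-+ p a (suc d) ⟨
    term p (a + suc d)             ≡⟨ eqᵇ ⟩
    term p' (a + suc d)            ≡⟨ term-+ p' a (suc d) ⟩
    term p' a + suc d * slope p'   ≡⟨ cong (_+ suc d * slope p') eqᵃ ⟨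
    term p a + suc d * slope p'    ∎))
  where open ≡-Reasoning

≡-by-two-terms : ∀ {p p' a b} → a ≢ b → term p a ≡ term p' a → term p b ≡ term p' b → p ≡ p'
≡-by-two-terms {p} {p'} {a} {b} a≢b eqᵃ eqᵇ with <-cmp a b
... | tri≈ _ a≡b _ = contradiction a≡b a≢b
... | tri< a<b _ _ with d , refl ← <⇒∃+suc a<b =
  ≡-by-term-and-slope a eqᵃ (slope-≡-by-two-terms p p' a d eqᵃ eqᵇ)
... | tri> _ _ b<a with d , refl ← <⇒∃+suc b<a =
  ≡-by-term-and-slope b eqᵇ (slope-≡-by-two-terms p p' b d eqᵇ eqᵃ)

triangle-slope-relation : ∀ p₁ p₂ p₃ a d e →
  term p₁ a ≡ term p₃ a → term p₁ (a + d) ≡ term p₂ (a + d) →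
  term p₂ (a + d + e) ≡ term p₃ (a + d + e) →
  d * slope p₁ + e * slope p₂ ≡ (d + e) * slope p₃
triangle-slope-relation p₁ p₂ p₃ a d e meet₁₃ meet₁₂ meet₂₃ =
  +-cancelˡ-≡ (term p₁ a) _ _ (begin
    term p₁ a + (d * k₁ + e * k₂)  ≡⟨ +-assoc (term p₁ a) (d * k₁) (e * k₂) ⟨
    term p₁ a + d * k₁ + e * k₂    ≡⟨ cong (_+ e * k₂) (term-+ p₁ a d) ⟨
    term p₁ (a + d) + e * k₂       ≡⟨ cong (_+ e * k₂) meet₁₂ ⟩
    term p₂ (a + d) + e * k₂       ≡⟨ term-+ p₂ (a + d) e ⟨
    term p₂ (a + d + e)            ≡⟨ meet₂₃ ⟩
    term p₃ (a + d + e)            ≡⟨ cong (term p₃) (+-assoc a d e) ⟩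
    term p₃ (a + (d + e))          ≡⟨ term-+ p₃ a (d + e) ⟩
    term p₃ a + (d + e) * k₃       ≡⟨ cong (_+ (d + e) * k₃) meet₁₃ ⟨
    term p₁ a + (d + e) * k₃       ∎)
  where
  open ≡-Reasoning
  k₁ = slope p₁
  k₂ = slope p₂
  k₃ = slope p₃

offsets-≤ : ∀ {q} a d e → a + suc d + suc e ≤ suc q → suc d ≤ q × suc e ≤ q
offsets-≤ {q} a d e bound =
  ≤-trans (m<m+n d z<s) d+1+e≤q , ≤-trans (m≤n+m (suc e) d) d+1+e≤q
  where
  d+1+e≤q : d + suc e ≤ q
  d+1+e≤q = s≤s⁻¹ (m+n≤o⇒n≤o a (subst (_≤ suc q) (+-assoc a (suc d) (suc e)) bound))

EdgeOfCopy-sym : ∀ {t p u v} → EdgeOfCopy t p u v → EdgeOfCopy t p v u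
EdgeOfCopy-sym (u≢v , u∈p , v∈p) = ≢-sym u≢v , v∈p , u∈p

edge-rows-distinct : ∀ {t p a b x y} → EdgeOfCopy t p (suc a , x) (suc b , y) → a ≢ b
edge-rows-distinct {a = a} (x≢y , (_ , _ , x∈p) , (_ , _ , y∈p)) refl =
  x≢y (cong (suc a ,_) (trans x∈p (sym y∈p)))

edge-determines-copy : ∀ {t p p' u v} → EdgeOfCopy t p u v → EdgeOfCopy t p' u v → p ≡ p'
edge-determines-copy {u = suc a , _} {v = suc b , _}
  uv@(_ , (_ , _ , u∈p) , (_ , _ , v∈p)) (_ , (_ , _ , u∈p') , (_ , _ , v∈p')) =
  ≡-by-two-terms (edge-rows-distinct uv) (trans (sym u∈p) u∈p') (trans (sym v∈p) v∈p')

first-edge : ∀ {t} p → 2 ≤ t → EdgeOfCopy t p (1 , term p 0) (2 , term p 1)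
first-edge p 2≤t =
  (λ ()) , (s≤s z≤n , ≤-trans (s≤s z≤n) 2≤t , refl) , (s≤s z≤n , 2≤t , refl)

copy-⊆⇒≡ : ∀ {t p p'} → 2 ≤ t → (∀ v → InCopy t p v → InCopy t p' v) → p ≡ p'
copy-⊆⇒≡ {p = p} 2≤t p⊆p' with edge@(u≢v , u∈p , v∈p) ← first-edge p 2≤t =
  edge-determines-copy edge (u≢v , p⊆p' _ u∈p , p⊆p' _ v∈p)

module _ {q : ℕ} {A : ℕ → Set} (noTriple : NoLimitedRatioTriple q A) where

  no-sorted-meeting-triangle : ∀ {p₁ p₂ p₃ a b c} →
    A (slope p₁) → A (slope p₂) → A (slope p₃) → p₁ ≢ p₂ → p₂ ≢ p₃ → p₁ ≢ p₃ →
    a < b → b < c → c ≤ suc q →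
    term p₁ a ≡ term p₃ a → term p₁ b ≡ term p₂ b → term p₂ c ≡ term p₃ c → ⊥
  no-sorted-meeting-triangle {p₁} {p₂} {p₃} {a}
    A₁ A₂ A₃ p₁≢p₂ p₂≢p₃ p₁≢p₃ a<b b<c c≤1+q meet₁₃ meet₁₂ meet₂₃
    with d , refl ← <⇒∃+suc a<b | e , refl ← <⇒∃+suc b<c =
    noTriple (slope p₁) (slope p₂) (slope p₃) (suc d) (suc e) A₁ A₂ A₃
      (p₁≢p₂ ∘ ≡-by-term-and-slope (a + suc d) meet₁₂)
      (p₂≢p₃ ∘ ≡-by-term-and-slope (a + suc d + suc e) meet₂₃)
      (p₁≢p₃ ∘ ≡-by-term-and-slope a meet₁₃)
      (s≤s z≤n) (proj₁ offsets) (s≤s z≤n) (proj₂ offsets)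
      (triangle-slope-relation p₁ p₂ p₃ a (suc d) (suc e) meet₁₃ meet₁₂ meet₂₃)
    where offsets = offsets-≤ a d e c≤1+q

  no-sorted-rainbow-triangle : ∀ {p₁ p₂ p₃ a b c x y z} →
    A (slope p₁) → A (slope p₂) → A (slope p₃) → p₁ ≢ p₂ → p₂ ≢ p₃ → p₁ ≢ p₃ →
    EdgeOfCopy (2 + q) p₁ (suc a , x) (suc b , y) →
    EdgeOfCopy (2 + q) p₂ (suc b , y) (suc c , z) →
    EdgeOfCopy (2 + q) p₃ (suc a , x) (suc c , z) → a < b → b < c → ⊥
  no-sorted-rainbow-triangle A₁ A₂ A₃ p₁≢p₂ p₂≢p₃ p₁≢p₃
    (_ , (_ , _ , x∈p₁) , (_ , _ , y∈p₁)) (_ , (_ , _ , y∈p₂) , (_ , c<2+q , z∈p₂))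
    (_ , (_ , _ , x∈p₃) , (_ , _ , z∈p₃)) a<b b<c =
    no-sorted-meeting-triangle A₁ A₂ A₃ p₁≢p₂ p₂≢p₃ p₁≢p₃ a<b b<c (s≤s⁻¹ c<2+q)
      (trans (sym x∈p₁) x∈p₃) (trans (sym y∈p₁) y∈p₂) (trans (sym z∈p₂) z∈p₃)

  no-rainbow-triangle : ∀ {p₁ p₂ p₃ x y z} →
    A (slope p₁) → A (slope p₂) → A (slope p₃) → p₁ ≢ p₂ → p₂ ≢ p₃ → p₁ ≢ p₃ →
    EdgeOfCopy (2 + q) p₁ x y → EdgeOfCopy (2 + q) p₂ y z → EdgeOfCopy (2 + q) p₃ x z → ⊥
  no-rainbow-triangle {x = suc a , _} {suc b , _} {suc c , _}
    A₁ A₂ A₃ p₁≢p₂ p₂≢p₃ p₁≢p₃ xy yz xz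
    with <-cmp a b | <-cmp b c | <-cmp a c
  ... | tri≈ _ a≡b _ | _ | _ = edge-rows-distinct xy a≡b
  ... | _ | tri≈ _ b≡c _ | _ = edge-rows-distinct yz b≡c
  ... | _ | _ | tri≈ _ a≡c _ = edge-rows-distinct xz a≡c
  ... | tri< a<b _ _ | tri< b<c _ _ | _ =
    no-sorted-rainbow-triangle A₁ A₂ A₃ p₁≢p₂ p₂≢p₃ p₁≢p₃
      xy yz xz a<b b<c
  ... | tri< _ _ _ | tri> _ _ c<b | tri< a<c _ _ =
    no-sorted-rainbow-triangle A₃ A₂ A₁ (≢-sym p₂≢p₃) (≢-sym p₁≢p₂) (≢-sym p₁≢p₃)
      xz (EdgeOfCopy-sym yz) xy a<c c<b
  ... | tri< a<b _ _ | tri> _ _ _ | tri> _ _ c<a =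
    no-sorted-rainbow-triangle A₃ A₁ A₂ (≢-sym p₁≢p₃) p₁≢p₂ (≢-sym p₂≢p₃)
      (EdgeOfCopy-sym xz) xy (EdgeOfCopy-sym yz) c<a a<b
  ... | tri> _ _ b<a | tri< _ _ _ | tri< a<c _ _ =
    no-sorted-rainbow-triangle A₁ A₃ A₂ p₁≢p₃ (≢-sym p₂≢p₃) p₁≢p₂
      (EdgeOfCopy-sym xy) xz yz b<a a<c
  ... | tri> _ _ _ | tri< b<c _ _ | tri> _ _ c<a =
    no-sorted-rainbow-triangle A₂ A₃ A₁ p₂≢p₃ (≢-sym p₁≢p₃) (≢-sym p₁≢p₂)
      yz (EdgeOfCopy-sym xz) (EdgeOfCopy-sym xy) b<c c<a
  ... | tri> _ _ b<a | tri> _ _ c<b | _ =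
    no-sorted-rainbow-triangle A₂ A₁ A₃ (≢-sym p₁≢p₂) p₁≢p₃ p₂≢p₃
      (EdgeOfCopy-sym yz) (EdgeOfCopy-sym xy) (EdgeOfCopy-sym xz) c<b b<a

mainTheorem6 :
    (t n : ℕ) → 3 ≤ t → 1 ≤ n → (A : ℕ → Set) →
    SubsetOf1toN n A → NoLimitedRatioTriple (t ∸ 2) A →
    -- (1) the copies of K_t are pairwise edge-disjoint
    (∀ p p' u v → ValidParam n A p → ValidParam n A p' →
       EdgeOfCopy t p u v → EdgeOfCopy t p' u v → p ≡ p')
    -- (2) no triangle whose three edges lie in three different copies
    × (∀ p₁ p₂ p₃ x y z →
       ValidParam n A p₁ → ValidParam n A p₂ → ValidParam n A p₃ →
       ¬ (p₁ ≡ p₂) → ¬ (p₂ ≡ p₃) → ¬ (p₁ ≡ p₃) →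
       EdgeOfCopy t p₁ x y → EdgeOfCopy t p₂ y z → EdgeOfCopy t p₃ x z →
       ¬ (x ≡ y) → ¬ (y ≡ z) → ¬ (x ≡ z) → ⊥)
    -- (3) distinct parameters give distinct t-sets, so there are n|A| copies
    × (∀ p p' → ValidParam n A p → ValidParam n A p' → ¬ (p ≡ p') →
       ¬ (∀ v → InCopy t p v ⇔ InCopy t p' v))
mainTheorem6 (suc (suc _)) _ (s≤s (s≤s _)) _ _ _ noTriple =
    (λ _ _ _ _ _ _ → edge-determines-copy)
  , (λ { _ _ _ _ _ _ (_ , _ , A₁) (_ , _ , A₂) (_ , _ , A₃) p₁≢p₂ p₂≢p₃ p₁≢p₃ xy yz xz
           _ _ _ →
         no-rainbow-triangle noTriple A₁ A₂ A₃ p₁≢p₂ p₂≢p₃ p₁≢p₃ xy yz xz })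
  , λ _ _ _ _ p≢p' same → p≢p' (copy-⊆⇒≡ (s≤s (s≤s z≤n)) (Equivalence.to ∘ same))
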